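{- Let $(H,k,\chi)$ be an instance of Precoloring Extension where $H$ has at least one edge, and consider the $P_n\,|\,\mathrm{conc}\,|\,C_{\max}$ instance constructed from it as described in the context. If there is a solution $\chi':\{1,\ldots,n\}\to\{1,\ldots,k\}$ to $(H,k,\chi)$, then there is a feasible schedule $C$ for the constructed instance with $C_{\max}\le k$.
   Context: Precoloring Extension: given a graph $H=(V,F)$ with $V=\{1,\ldots,n\}$, an integer $k$, and a proper coloring $\chi:V_0\to\{1,\ldots,k\}$ of $H[V_0]$ for some $V_0\subseteq V$; a solution is a proper coloring $\chi':V\to\{1,\ldots,k\}$ of $H$ with $\chi'(v)=\chi(v)$ for all $v\in V_0$. Scheduling: jobs with positive integer processing times $p_j$, all release times $0$, conflict graph $G$; a schedule $C$ (completion times in $\mathbb{N}$) is feasible if $C_j-p_j\ge0$ for all jobs and $[C_i-p_i,C_i)\cap[C_j-p_j,C_j)=\emptyset$ for every edge $\{i,j\}$ of $G$; $C_{\max}=\max_jC_j$. Construction: start with $G=H$, with $p_j=1$ for each $j\in V$. Add jobs $a,a',b,b'$ with $p_a=p_b=1$, $p_{a'}=p_{b'}=k-1$, and edges $\{a,a'\},\{b,b'\},\{a,b\}$. For each $j\in V_0$ with $\chi(j)\in\{2,\ldots,k-1\}$, add jobs $j(1),j(2)$ with $p_{j(1)}=\chi(j)-1$, $p_{j(2)}=k-\chi(j)$, and edges $\{j,j(1)\},\{j,j(2)\},\{j(1),j(2)\},\{a,j\},\{b,j\},\{a,j(2)\},\{b,j(1)\}$. For $j\in V_0$ with $\chi(j)=1$,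 add only $j(2)$ (with $p_{j(2)}=k-1$) and edges $\{j,j(2)\},\{b,j\},\{a,j(2)\}$. For $j\in V_0$ with $\chi(j)=k$, add only $j(1)$ (with $p_{j(1)}=k-1$) and edges $\{j,j(1)\},\{a,j\},\{b,j(1)\}$. -}

module Defs where

open import Data.Nat using (ℕ; _≤_; _<_; _∸_; _+_)
open import Data.Fin using (Fin)
open import Data.Maybe using (Maybe; just; nothing)
open import Data.Product using (_×_; Σ; ∃; ∃-syntax)
open import Relation.Binary.PropositionalEquality using (_≡_; _≢_)
open import Relation.Nullary using (¬_)

record Graph (n : ℕ) : Set₁ where
  field
    Adj     : Fin n → Fin n → Set
    sym     : ∀ {u v} → Adj u v → Adj v u
    irrefl  : ∀ {u} → ¬ Adj u u

open Graph public

HasEdge : ∀ {n} → Graph n → Set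
HasEdge H = ∃[ u ] ∃[ v ] Adj H u v

-- Partial precoloring: χ j ≡ just c means j ∈ V₀ and χ(j) = c; nothing means j ∉ V₀.
-- Colours are the natural numbers 1..k.
IsPrecoloring : ∀ {n} → Graph n → ℕ → (Fin n → Maybe ℕ) → Set
IsPrecoloring H k χ =
  (∀ j c → χ j ≡ just c → 1 ≤ c × c ≤ k) ×
  (∀ u v c d → Adj H u v → χ u ≡ just c → χ v ≡ just d → c ≢ d)

IsExtension : ∀ {n} → Graph n → ℕ → (Fin n → Maybe ℕ) → (Fin n → ℕ) → Set
IsExtension H k χ χ' =
  (∀ j → 1 ≤ χ' j × χ' j ≤ k) ×
  (∀ u v → Adj H u v → χ' u ≢ χ' v) ×
  (∀ j c → χ j ≡ just c → χ' j ≡ c)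

module Construction {n : ℕ} (H : Graph n) (k : ℕ) (χ : Fin n → Maybe ℕ) where

  data Job : Set where
    orig : Fin n → Job
    a a' b b' : Job
    j1 : (j : Fin n) (c : ℕ) → χ j ≡ just c → 2 ≤ c → Job
    j2 : (j : Fin n) (c : ℕ) → χ j ≡ just c → c < k → Job

  p : Job → ℕ
  p (orig _)     = 1
  p a            = 1
  p b            = 1
  p a'           = k ∸ 1
  p b'           = k ∸ 1
  p (j1 _ c _ _) = c ∸ 1
  p (j2 _ c _ _) = k ∸ c

  -- edges of the conflict graph G (each unordered edge listed once, one orientation)
  data Edge : Job → Job → Set where
    e-H    : ∀ {u v} → Adj H u v → Edge (orig u) (orig v)
    e-aa'  : Edge a a'
    e-bb'  : Edge b b'
    e-ab   : Edge a b
    e-j-j1 : ∀ {j c eq h} → Edge (orig j) (j1 j c eq h)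
    e-j-j2 : ∀ {j c eq h} → Edge (orig j) (j2 j c eq h)
    e-j1j2 : ∀ {j c c' eq eq' h h'} → Edge (j1 j c eq h) (j2 j c' eq' h')
    e-a-j  : ∀ {j c} → χ j ≡ just c → 2 ≤ c → Edge a (orig j)
    e-b-j  : ∀ {j c} → χ j ≡ just c → c < k → Edge b (orig j)
    e-a-j2 : ∀ {j c eq h} → Edge a (j2 j c eq h)
    e-b-j1 : ∀ {j c eq h} → Edge b (j1 j c eq h)

  InInterval : (Job → ℕ) → Job → ℕ → Set
  InInterval C x t = (C x ∸ p x ≤ t) × (t < C x)

  Feasible : (Job → ℕ) → Set
  Feasible C =
    (∀ x → p x ≤ C x) ×
    (∀ x y → Edge x y → ∀ t → ¬ (InInterval C x t × InInterval C y t))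

  MakespanAtMost : (Job → ℕ) → ℕ → Set
  MakespanAtMost C T = ∀ x → C x ≤ T

-- Read the time slot [c-1, c) as colour c and run each vertex job j in the slot of χ'(j), so
-- adjacent vertices never overlap. Job a takes the first slot and b the last, with a' and b'
-- filling the other k-1 slots; for a precoloured j of colour c, j(1) fills the slots before c
-- and j(2) those after it. Every edge of the construction then joins two jobs one of which ends
-- before the other starts. This needs k ≥ 2, which holds because H has an edge.
module Submission where

open import Defs hiding (sym)
open import Data.Nat using (ℕ; suc; _≤_; _<_; _∸_; s≤s; z≤n)
open import Data.Nat.Properties
  using (module ≤-Reasoning; ≤-refl; ≤-trans; ≤-reflexive; <-irrefl; <-≤-trans; <-cmp
        ; m∸n≤m; ∸-monoˡ-≤; m∸[m∸n]≡n)
open import Data.Fin using (Fin)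
open import Data.Maybe using (Maybe; just)
open import Data.Product using (Σ; _×_; _,_; proj₁; proj₂)
open import Data.Sum using (_⊎_; inj₁; inj₂)
open import Relation.Binary using (tri<; tri≈; tri>)
open import Relation.Binary.PropositionalEquality using (_≡_; _≢_; refl; sym; trans; subst)
open import Relation.Nullary using (¬_; contradiction)

distinct-in-[1,k]⇒2≤k : ∀ {x y k} → 1 ≤ x → x ≤ k → 1 ≤ y → y ≤ k → x ≢ y → 2 ≤ k
distinct-in-[1,k]⇒2≤k {suc (suc _)} _ x≤k _ _ _ = ≤-trans (s≤s (s≤s z≤n)) x≤k
distinct-in-[1,k]⇒2≤k {suc _} {suc (suc _)} _ _ _ y≤k _ = ≤-trans (s≤s (s≤s z≤n)) y≤k
distinct-in-[1,k]⇒2≤k {1} {1} _ _ _ _ 1≢1 = contradiction refl 1≢1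

extension-of-edge⇒2≤k : ∀ {n} {H : Graph n} {k χ χ'} → HasEdge H → IsExtension H k χ χ' → 2 ≤ k
extension-of-edge⇒2≤k (u , v , uv) (range , proper , _) =
  distinct-in-[1,k]⇒2≤k (proj₁ (range u)) (proj₂ (range u)) (proj₁ (range v)) (proj₂ (range v))
    (proper u v uv)

module Schedule {n : ℕ} (H : Graph n) (k : ℕ) (χ : Fin n → Maybe ℕ) (2≤k : 2 ≤ k) where
  open Construction H k χ

  EndsBefore : (Job → ℕ) → Job → Job → Set
  EndsBefore C x y = C x ≤ C y ∸ p y

  endsBefore⇒disjoint : ∀ C x y → EndsBefore C x y ⊎ EndsBefore C y x →
                        ∀ t → ¬ (InInterval C x t × InInterval C y t)
  endsBefore⇒disjoint _ _ _ (inj₁ x≺y) t ((_ , t<Cx) , (Cy-py≤t , _)) =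
    <-irrefl refl (<-≤-trans t<Cx (≤-trans x≺y Cy-py≤t))
  endsBefore⇒disjoint _ _ _ (inj₂ y≺x) t ((Cx-px≤t , _) , (_ , t<Cy)) =
    <-irrefl refl (<-≤-trans t<Cy (≤-trans y≺x Cx-px≤t))

  1≤k : 1 ≤ k
  1≤k = ≤-trans (s≤s z≤n) 2≤k

  module _ (χ' : Fin n → ℕ) (ext : IsExtension H k χ χ') where
    private
      range = proj₁ ext
      proper = proj₁ (proj₂ ext)

      extends : ∀ {j c} → χ j ≡ just c → χ' j ≡ c
      extends {j} {c} = proj₂ (proj₂ ext) j c

      precolour-range : ∀ {j c} → χ j ≡ just c → 1 ≤ c × c ≤ k
      precolour-range {j} χj≡c = subst (λ c → 1 ≤ c × c ≤ k) (extends χj≡c) (range j)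

    C : Job → ℕ
    C (orig j)     = χ' j
    C a            = 1
    C a'           = k
    C b            = k
    C b'           = k ∸ 1
    C (j1 _ c _ _) = c ∸ 1
    C (j2 _ c _ _) = k

    starts-after-release : ∀ x → p x ≤ C x
    starts-after-release (orig j)     = proj₁ (range j)
    starts-after-release a            = ≤-refl
    starts-after-release a'           = m∸n≤m k 1
    starts-after-release b            = 1≤k
    starts-after-release b'           = ≤-refl
    starts-after-release (j1 _ _ _ _) = ≤-refl
    starts-after-release (j2 _ c _ _) = m∸n≤m k c

    ends-by-k : MakespanAtMost C k
    ends-by-k (orig j)          = proj₂ (range j)
    ends-by-k a                 = 1≤k
    ends-by-k a'                = ≤-refl
    ends-by-k b                 = ≤-refl
    ends-by-k b'                = m∸n≤m k 1
    ends-by-k (j1 _ c χj≡c _)   = ≤-trans (m∸n≤m c 1) (proj₂ (precolour-range χj≡c))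
    ends-by-k (j2 _ _ _ _)      = ≤-refl

    starts-at-colour : ∀ {j c} → χ j ≡ just c → k ∸ (k ∸ c) ≡ c
    starts-at-colour χj≡c = m∸[m∸n]≡n (proj₂ (precolour-range χj≡c))

    -- ∸-monoˡ-≤ 1 turns m < n into m ≤ n ∸ 1, since suc m ∸ 1 reduces to m.
    edge⇒endsBefore : ∀ {x y} → Edge x y → EndsBefore C x y ⊎ EndsBefore C y x
    edge⇒endsBefore (e-H {u} {v} uv) with <-cmp (χ' u) (χ' v)
    ... | tri< u<v _ _ = inj₁ (∸-monoˡ-≤ 1 u<v)
    ... | tri≈ _ u≡v _ = contradiction u≡v (proper u v uv)
    ... | tri> _ _ v<u = inj₂ (∸-monoˡ-≤ 1 v<u)
    edge⇒endsBefore e-aa' = inj₁ (≤-reflexive (sym (m∸[m∸n]≡n 1≤k)))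
    edge⇒endsBefore e-bb' = inj₂ ≤-refl
    edge⇒endsBefore e-ab  = inj₁ (∸-monoˡ-≤ 1 2≤k)
    edge⇒endsBefore (e-j-j1 {eq = χj≡c}) = inj₂ (∸-monoˡ-≤ 1 (≤-reflexive (sym (extends χj≡c))))
    edge⇒endsBefore (e-j-j2 {eq = χj≡c}) =
      inj₁ (≤-reflexive (trans (extends χj≡c) (sym (starts-at-colour χj≡c))))
    edge⇒endsBefore (e-j1j2 {j = j} {c = c} {c' = c'} {eq = χj≡c} {eq' = χj≡c'}) = inj₁ (begin
      c ∸ 1        ≤⟨ m∸n≤m c 1 ⟩
      c            ≡⟨ sym (extends χj≡c) ⟩
      χ' j         ≡⟨ extends χj≡c' ⟩
      c'           ≡⟨ sym (starts-at-colour χj≡c') ⟩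
      k ∸ (k ∸ c') ∎)
      where open ≤-Reasoning
    edge⇒endsBefore (e-a-j χj≡c 2≤c) = inj₁ (∸-monoˡ-≤ 1 (subst (2 ≤_) (sym (extends χj≡c)) 2≤c))
    edge⇒endsBefore (e-b-j χj≡c c<k) = inj₂ (∸-monoˡ-≤ 1 (subst (_< k) (sym (extends χj≡c)) c<k))
    edge⇒endsBefore (e-a-j2 {eq = χj≡c}) =
      inj₁ (subst (1 ≤_) (sym (starts-at-colour χj≡c)) (proj₁ (precolour-range χj≡c)))
    edge⇒endsBefore (e-b-j1 {eq = χj≡c}) = inj₂ (∸-monoˡ-≤ 1 (proj₂ (precolour-range χj≡c)))

    feasible : Feasible C
    feasible = starts-after-release , λ x y xy → endsBefore⇒disjoint C x y (edge⇒endsBefore xy)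

lemma9 : {n : ℕ} (H : Graph n) (k : ℕ) (χ : Fin n → Maybe ℕ)
    → IsPrecoloring H k χ
    → HasEdge H
    → Σ (Fin n → ℕ) (IsExtension H k χ)
    → Σ (Construction.Job H k χ → ℕ) (λ C →
    Construction.Feasible H k χ C × Construction.MakespanAtMost H k χ C k)
lemma9 H k χ _ edge (χ' , ext) = C χ' ext , feasible χ' ext , ends-by-k χ' ext
  where open Schedule H k χ (extension-of-edge⇒2≤k {H = H} edge ext)
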